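{- Let $G$ be a graph containing neither a bull nor a chair as an induced subgraph, and let $\overline{Q}$ be an induced odd antihole in $G$ on vertices $v_1,\ldots,v_p$ ($p\geq 5$ odd), where $v_iv_j\notin E(G)$ exactly when $j\equiv i\pm 1\pmod p$. Let $N(\overline{Q})$ be the set of vertices outside $\overline{Q}$ adjacent to some vertex of $\overline{Q}$, and $N_2(\overline{Q})$ the set of vertices at distance exactly $2$ from $V(\overline{Q})$. If a vertex $w\in N_2(\overline{Q})$ is adjacent to a vertex $w'\in N(\overline{Q})$, then $w'$ is adjacent to all vertices of $\overline{Q}$.
   Context: A bull is the graph with vertices $v_1,\ldots,v_5$ and edges $v_1v_2,v_2v_3,v_3v_4,v_4v_5,v_2v_4$. A chair is the graph obtained from $K_{1,3}$ by subdividing one edge once. An odd antihole is an induced subgraph whose complement is a cycle of odd length at least $5$. -}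

module Defs where

open import Data.Nat using (ℕ; suc; _+_; _%_; _≤_)
open import Data.Fin using (Fin; toℕ)
open import Data.Bool using (Bool; true; false)
open import Data.Product using (Σ; ∃; _×_; _,_)
open import Data.Sum using (_⊎_)
open import Relation.Binary.PropositionalEquality using (_≡_; _≢_)
open import Relation.Nullary using (¬_)
open import Function.Bundles using (_⇔_)
open import Function.Definitions using (Injective)

record Graph (n : ℕ) : Set where
  field
    adj   : Fin n → Fin n → Bool
    sym   : ∀ u v → adj u v ≡ adj v u
    irrefl : ∀ v → adj v v ≡ false
open Graph public

-- Bull on 0..4 : edges 01, 12, 23, 34, 13  (v1..v5 of the paper = 0..4)
bullAdj : Fin 5 → Fin 5 → Bool
bullAdj Fin.zero (Fin.suc Fin.zero) = true
bullAdj (Fin.suc Fin.zero) Fin.zero = true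
bullAdj (Fin.suc Fin.zero) (Fin.suc (Fin.suc Fin.zero)) = true
bullAdj (Fin.suc (Fin.suc Fin.zero)) (Fin.suc Fin.zero) = true
bullAdj (Fin.suc (Fin.suc Fin.zero)) (Fin.suc (Fin.suc (Fin.suc Fin.zero))) = true
bullAdj (Fin.suc (Fin.suc (Fin.suc Fin.zero))) (Fin.suc (Fin.suc Fin.zero)) = true
bullAdj (Fin.suc (Fin.suc (Fin.suc Fin.zero))) (Fin.suc (Fin.suc (Fin.suc (Fin.suc Fin.zero)))) = true
bullAdj (Fin.suc (Fin.suc (Fin.suc (Fin.suc Fin.zero)))) (Fin.suc (Fin.suc (Fin.suc Fin.zero))) = true
bullAdj (Fin.suc Fin.zero) (Fin.suc (Fin.suc (Fin.suc Fin.zero))) = true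
bullAdj (Fin.suc (Fin.suc (Fin.suc Fin.zero))) (Fin.suc Fin.zero) = true
bullAdj _ _ = false

-- Chair: K_{1,3} with centre 2 and leaves 0, 1, 3, where edge 2-4 of the
-- star is subdivided by vertex 3: edges 02, 12, 23, 34.
chairAdj : Fin 5 → Fin 5 → Bool
chairAdj Fin.zero (Fin.suc (Fin.suc Fin.zero)) = true
chairAdj (Fin.suc (Fin.suc Fin.zero)) Fin.zero = true
chairAdj (Fin.suc Fin.zero) (Fin.suc (Fin.suc Fin.zero)) = true
chairAdj (Fin.suc (Fin.suc Fin.zero)) (Fin.suc Fin.zero) = true
chairAdj (Fin.suc (Fin.suc Fin.zero)) (Fin.suc (Fin.suc (Fin.suc Fin.zero))) = true
chairAdj (Fin.suc (Fin.suc (Fin.suc Fin.zero))) (Fin.suc (Fin.suc Fin.zero)) = true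
chairAdj (Fin.suc (Fin.suc (Fin.suc Fin.zero))) (Fin.suc (Fin.suc (Fin.suc (Fin.suc Fin.zero)))) = true
chairAdj (Fin.suc (Fin.suc (Fin.suc (Fin.suc Fin.zero)))) (Fin.suc (Fin.suc (Fin.suc Fin.zero))) = true
chairAdj _ _ = false

ContainsInduced : ∀ {n} → Graph n → (k : ℕ) → (Fin k → Fin k → Bool) → Set
ContainsInduced G k H =
  Σ (Fin k → Fin _) λ f → Injective _≡_ _≡_ f ×
    (∀ i j → i ≢ j → adj G (f i) (f j) ≡ H i j)

BullFree : ∀ {n} → Graph n → Set
BullFree G = ¬ ContainsInduced G 5 bullAdj

ChairFree : ∀ {n} → Graph n → Set
ChairFree G = ¬ ContainsInduced G 5 chairAdj

Consecutive : (p : ℕ) → Fin p → Fin p → Set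
Consecutive (suc p) i j =
  toℕ j ≡ (toℕ i + 1) % suc p ⊎ toℕ i ≡ (toℕ j + 1) % suc p
Consecutive ℕ.zero i j = Data.Fin.Fin 0

IsOddAntihole : ∀ {n} → Graph n → (p : ℕ) → (Fin p → Fin n) → Set
IsOddAntihole G p v =
  5 ≤ p × p % 2 ≡ 1 × Injective _≡_ _≡_ v ×
  (∀ i j → i ≢ j → (adj G (v i) (v j) ≡ false ⇔ Consecutive p i j))

InQ : ∀ {n p} → (Fin p → Fin n) → Fin n → Set
InQ v x = ∃ λ i → v i ≡ x

InN : ∀ {n p} → Graph n → (Fin p → Fin n) → Fin n → Set
InN G v x = ¬ InQ v x × ∃ λ i → adj G x (v i) ≡ true

InN₂ : ∀ {n p} → Graph n → (Fin p → Fin n) → Fin n → Set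
InN₂ G v x = ¬ InQ v x × ¬ InN G v x ×
  ∃ λ u → InN G v u × adj G x u ≡ true

-- If w′ missed some vertex of the antihole, walking around it from a
-- neighbour of w′ would give consecutive vertices with w′ ∼ vₛ and w′ ≁ vₛ₊₁.
-- The four consecutive vertices a, b, c, d = vₛ, …, vₛ₊₃ induce the path
-- c – a – d – b, and w is adjacent to w′ but to none of them. According to
-- whether w′ sees d, sees c but not d, or sees neither, the sets
-- {w, w′, a, d, b}, {w, w′, c, a, d} or {c, d, a, w′, w} induce a bull, a bull
-- or a chair.
module Submission where

open import Defs
open import Data.Nat using (ℕ; zero; suc; _+_; _∸_; _%_; _≤_; _<_; NonZero; z≤n; s≤s; z<s; s≤s⁻¹)
open import Data.Nat.Properties
  using (+-comm; +-cancelʳ-≡; +-cancelʳ-<; +-mono-<; +-suc; m∸n+n≡m; <⇒≢; <⇒≤; ≤-refl; ≤-reflexive; ≤-trans; ≮⇒≥; m≤n+m; m≤n⇒m<n∨m≡n)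
  renaming (_<?_ to _<ℕ?_)
open import Data.Nat.DivMod using (_mod_; %-distribˡ-+; m%n%n≡m%n; m<n⇒m%n≡m; m%n<n; [m+n]%n≡m%n)
open import Data.Fin as Fin using (Fin; toℕ)
open import Data.Fin.Properties using (<-cmp; all?; toℕ<n; toℕ-fromℕ<; fromℕ<-cong; fromℕ<-toℕ)
open import Data.Bool using (Bool; true; false)
open import Data.Bool.Properties using (¬-not; not-¬) renaming (_≟_ to _≟ᵇ_)
open import Data.List using (tabulate; allFin)
import Data.List.Relation.Unary.All.Properties as All
open import Data.List.Relation.Unary.AllPairs using (AllPairs; []; _∷_)
open import Data.List.Relation.Unary.All using ([]; _∷_)
open import Data.Vec using ([]; _∷_; lookup)
open import Data.Product using (∃-syntax; _×_; _,_; proj₁; proj₂)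
open import Data.Sum using (_⊎_; inj₁; inj₂; [_,_]′)
open import Function using (_∘_)
open import Function.Bundles using (Equivalence; _⇔_)
open import Function.Definitions using (Injective)
open import Relation.Binary using (Rel; tri<; tri≈; tri>)
open import Relation.Nullary using (¬_; yes; no; contradiction)
open import Relation.Nullary.Decidable using (from-yes)
open import Relation.Unary using (Decidable)
open import Relation.Binary.PropositionalEquality
  using (_≡_; _≢_; refl; cong; trans; ≢-sym; module ≡-Reasoning)
  renaming (sym to ≡-sym)
open ≡-Reasoning

[m%n+1]%n≡[1+m]%n : ∀ m n .{{_ : NonZero n}} → (m % n + 1) % n ≡ suc m % n
[m%n+1]%n≡[1+m]%n m n = begin
  (m % n + 1) % n          ≡⟨ %-distribˡ-+ (m % n) 1 n ⟩
  (m % n % n + 1 % n) % n  ≡⟨ cong (λ x → (x + 1 % n) % n) (m%n%n≡m%n m n) ⟩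
  (m % n + 1 % n) % n      ≡⟨ ≡-sym (%-distribˡ-+ m 1 n) ⟩
  (m + 1) % n              ≡⟨ cong (_% n) (+-comm m 1) ⟩
  suc m % n                ∎

[d+r]%n≢r : ∀ {d r n} .{{_ : NonZero n}} → 0 < d → d < n → r < n → (d + r) % n ≢ r
[d+r]%n≢r {d} {r} {n} 0<d d<n r<n eq with d + r <ℕ? n
... | yes d+r<n = <⇒≢ 0<d (≡-sym (+-cancelʳ-≡ r d 0 (trans (≡-sym (m<n⇒m%n≡m d+r<n)) eq)))
... | no d+r≮n = <⇒≢ d<n (+-cancelʳ-≡ r d n (begin
    d + r      ≡⟨ ≡-sym t+n≡d+r ⟩
    t + n      ≡⟨ cong (_+ n) t≡r ⟩
    r + n      ≡⟨ +-comm r n ⟩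
    n + r      ∎))
  where
  t : ℕ
  t = d + r ∸ n
  t+n≡d+r : t + n ≡ d + r
  t+n≡d+r = m∸n+n≡m (≮⇒≥ d+r≮n)
  t<n : t < n
  t<n = +-cancelʳ-< n t n (≤-trans (≤-reflexive (cong suc t+n≡d+r)) (+-mono-< d<n r<n))
  t≡r : t ≡ r
  t≡r = begin
    t             ≡⟨ ≡-sym (m<n⇒m%n≡m t<n) ⟩
    t % n         ≡⟨ ≡-sym ([m+n]%n≡m%n t n) ⟩
    (t + n) % n   ≡⟨ cong (_% n) t+n≡d+r ⟩
    (d + r) % n   ≡⟨ eq ⟩
    r             ∎

[d+m]%n≢m%n : ∀ m {d n} .{{_ : NonZero n}} → 0 < d → d < n → (d + m) % n ≢ m % n
[d+m]%n≢m%n m {d} {n} 0<d d<n eq = [d+r]%n≢r 0<d d<n (m%n<n m n) (begin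
  (d + m % n) % n        ≡⟨ cong (λ x → (x + m % n) % n) (≡-sym (m<n⇒m%n≡m d<n)) ⟩
  (d % n + m % n) % n    ≡⟨ ≡-sym (%-distribˡ-+ d m n) ⟩
  (d + m) % n            ≡⟨ eq ⟩
  m % n                  ∎)

crossing : ∀ {ℓ} {P : ℕ → Set ℓ} → Decidable P →
  ∀ {m n} → m ≤ n → P m → ¬ P n → ∃[ s ] P s × ¬ P (suc s)
crossing P? {n = zero} z≤n Pm ¬Pn = contradiction Pm ¬Pn
crossing P? {m} {suc n} m≤1+n Pm ¬P1+n with P? n
... | yes Pn = n , Pn , ¬P1+n
... | no ¬Pn with m≤n⇒m<n∨m≡n m≤1+n
...   | inj₁ m<1+n = crossing P? (s≤s⁻¹ m<1+n) Pm ¬Pn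
...   | inj₂ refl = contradiction Pm ¬P1+n

tabulate⁻-< : ∀ {a ℓ} {A : Set a} {R : Rel A ℓ} {k} {f : Fin k → A} →
  AllPairs R (tabulate f) → ∀ {i j} → i Fin.< j → R (f i) (f j)
tabulate⁻-< {k = suc k} (Rf₀ ∷ _) {Fin.zero} {Fin.suc j} _ = All.tabulate⁻ Rf₀ j
tabulate⁻-< {k = suc k} (_ ∷ Rfs) {Fin.suc i} {Fin.suc j} (s≤s i<j) = tabulate⁻-< Rfs i<j

bullAdj-sym : ∀ i j → bullAdj i j ≡ bullAdj j i
bullAdj-sym = from-yes (all? λ i → all? λ j → bullAdj i j ≟ᵇ bullAdj j i)

chairAdj-sym : ∀ i j → chairAdj i j ≡ chairAdj j i
chairAdj-sym = from-yes (all? λ i → all? λ j → chairAdj i j ≟ᵇ chairAdj j i)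

module _ {n} (G : Graph n) where

  adj-sym : ∀ {x y b} → adj G x y ≡ b → adj G y x ≡ b
  adj-sym {x} {y} xy = trans (sym G y x) xy

  adjacent⇒≢ : ∀ {x y} → adj G x y ≡ true → x ≢ y
  adjacent⇒≢ {x} xx refl = not-¬ (irrefl G x) xx

  separated⇒≢ : ∀ {x y z} → adj G x z ≡ true → adj G y z ≡ false → x ≢ y
  separated⇒≢ xz yz refl = not-¬ yz xz

  Embeds : ∀ {k} → (Fin k → Fin k → Bool) → (Fin k → Fin n) → Fin k → Fin k → Set
  Embeds H f i j = f i ≢ f j × adj G (f i) (f j) ≡ H i j

  induced-from-pairs : ∀ {k} (H : Fin k → Fin k → Bool) → (∀ i j → H i j ≡ H j i) →
    (f : Fin k → Fin n) → AllPairs (Embeds H f) (allFin k) → ContainsInduced G k H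
  induced-from-pairs H H-sym f pairs = f , injective , edges
    where
    ordered : ∀ {i j} → i Fin.< j → Embeds H f i j
    ordered = tabulate⁻-< pairs
    injective : Injective _≡_ _≡_ f
    injective {i} {j} fi≡fj with <-cmp i j
    ... | tri< i<j _ _ = contradiction fi≡fj (proj₁ (ordered i<j))
    ... | tri≈ _ i≡j _ = i≡j
    ... | tri> _ _ j<i = contradiction (≡-sym fi≡fj) (proj₁ (ordered j<i))
    edges : ∀ i j → i ≢ j → adj G (f i) (f j) ≡ H i j
    edges i j i≢j with <-cmp i j
    ... | tri< i<j _ _ = proj₂ (ordered i<j)
    ... | tri≈ _ i≡j _ = contradiction i≡j i≢j
    ... | tri> _ _ j<i = trans (adj-sym (proj₂ (ordered j<i))) (H-sym j i)

module BullOrChair {n} (G : Graph n) {w w′ a b c d : Fin n}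
  (ww′ : adj G w w′ ≡ true) (w′a : adj G w′ a ≡ true) (w′b : adj G w′ b ≡ false)
  (wa : adj G w a ≡ false) (wb : adj G w b ≡ false) (wc : adj G w c ≡ false) (wd : adj G w d ≡ false)
  (ab : adj G a b ≡ false) (bc : adj G b c ≡ false) (cd : adj G c d ≡ false)
  (ac : adj G a c ≡ true) (bd : adj G b d ≡ true) (ad : adj G a d ≡ true) where

  private
    edge : ∀ {x y} → adj G x y ≡ true → x ≢ y × adj G x y ≡ true
    edge xy = adjacent⇒≢ G xy , xy

    w≢a : w ≢ a
    w≢a = ≢-sym (separated⇒≢ G ac wc)
    w≢b : w ≢ b
    w≢b = ≢-sym (separated⇒≢ G bd wd)
    w≢c : w ≢ c
    w≢c = ≢-sym (separated⇒≢ G (adj-sym G ac) wa)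
    w≢d : w ≢ d
    w≢d = ≢-sym (separated⇒≢ G (adj-sym G ad) wa)
    w′≢ : ∀ {x} → adj G w x ≡ false → w′ ≢ x
    w′≢ wx = separated⇒≢ G (adj-sym G ww′) (adj-sym G wx)
    a≢b : a ≢ b
    a≢b = separated⇒≢ G ac bc
    c≢d : c ≢ d
    c≢d = ≢-sym (separated⇒≢ G (adj-sym G bd) (adj-sym G bc))

  bull-through-d : adj G w′ d ≡ true → ContainsInduced G 5 bullAdj
  bull-through-d w′d = induced-from-pairs G bullAdj bullAdj-sym (lookup (w ∷ w′ ∷ a ∷ d ∷ b ∷ []))
    ( (edge ww′ ∷ (w≢a , wa) ∷ (w≢d , wd) ∷ (w≢b , wb) ∷ [])
    ∷ (edge w′a ∷ edge w′d ∷ (w′≢ wb , w′b) ∷ [])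
    ∷ (edge ad ∷ (a≢b , ab) ∷ [])
    ∷ (edge (adj-sym G bd) ∷ [])
    ∷ [] ∷ [])

  bull-through-c : adj G w′ c ≡ true → adj G w′ d ≡ false → ContainsInduced G 5 bullAdj
  bull-through-c w′c w′d = induced-from-pairs G bullAdj bullAdj-sym (lookup (w ∷ w′ ∷ c ∷ a ∷ d ∷ []))
    ( (edge ww′ ∷ (w≢c , wc) ∷ (w≢a , wa) ∷ (w≢d , wd) ∷ [])
    ∷ (edge w′c ∷ edge w′a ∷ (w′≢ wd , w′d) ∷ [])
    ∷ (edge (adj-sym G ac) ∷ (c≢d , cd) ∷ [])
    ∷ (edge ad ∷ [])
    ∷ [] ∷ [])

  chair : adj G w′ c ≡ false → adj G w′ d ≡ false → ContainsInduced G 5 chairAdj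
  chair w′c w′d = induced-from-pairs G chairAdj chairAdj-sym (lookup (c ∷ d ∷ a ∷ w′ ∷ w ∷ []))
    ( ((c≢d , cd) ∷ edge (adj-sym G ac) ∷ (≢-sym (w′≢ wc) , adj-sym G w′c) ∷ (≢-sym w≢c , adj-sym G wc) ∷ [])
    ∷ (edge (adj-sym G ad) ∷ (≢-sym (w′≢ wd) , adj-sym G w′d) ∷ (≢-sym w≢d , adj-sym G wd) ∷ [])
    ∷ (edge (adj-sym G w′a) ∷ (≢-sym w≢a , adj-sym G wa) ∷ [])
    ∷ (edge (adj-sym G ww′) ∷ [])
    ∷ [] ∷ [])

  bull-or-chair : ContainsInduced G 5 bullAdj ⊎ ContainsInduced G 5 chairAdj
  bull-or-chair with adj G w′ d in w′d | adj G w′ c in w′c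
  ... | true  | _     = inj₁ (bull-through-d w′d)
  ... | false | true  = inj₁ (bull-through-c w′c w′d)
  ... | false | false = inj₂ (chair w′c w′d)

module CyclicIndexing {n} (G : Graph n) (m : ℕ) (v : Fin (suc m) → Fin n)
  (nonadjacent⇔consecutive : ∀ i j → i ≢ j → (adj G (v i) (v j) ≡ false ⇔ Consecutive (suc m) i j))
  where

  private
    p : ℕ
    p = suc m

  -- v read periodically, so that walking around the antihole is arithmetic in ℕ
  V : ℕ → Fin n
  V s = v (s mod p)

  private
    toℕ-mod : ∀ s → toℕ (s mod p) ≡ s % p
    toℕ-mod s = toℕ-fromℕ< (m%n<n s p)

    toℕ-mod+1 : ∀ s → (toℕ (s mod p) + 1) % p ≡ suc s % p
    toℕ-mod+1 s = trans (cong (λ x → (x + 1) % p) (toℕ-mod s)) ([m%n+1]%n≡[1+m]%n s p)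

    mod-distinct : ∀ s {d} → 0 < d → d < p → s mod p ≢ (d + s) mod p
    mod-distinct s {d} 0<d d<p eq = [d+m]%n≢m%n s 0<d d<p (begin
      (d + s) % p           ≡⟨ ≡-sym (toℕ-mod (d + s)) ⟩
      toℕ ((d + s) mod p)   ≡⟨ cong toℕ (≡-sym eq) ⟩
      toℕ (s mod p)         ≡⟨ toℕ-mod s ⟩
      s % p                 ∎)

  V-toℕ : ∀ i → V (toℕ i) ≡ v i
  V-toℕ i = cong v (trans (fromℕ<-cong _ _ (m<n⇒m%n≡m (toℕ<n i)) _ (toℕ<n i)) (fromℕ<-toℕ i (toℕ<n i)))

  V-periodic : ∀ s → V (s + p) ≡ V s
  V-periodic s = cong v (fromℕ<-cong _ _ ([m+n]%n≡m%n s p) _ _)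

  V-nonadjacent-suc : 1 < p → ∀ s → adj G (V s) (V (suc s)) ≡ false
  V-nonadjacent-suc 1<p s = Equivalence.from (nonadjacent⇔consecutive _ _ (mod-distinct s z<s 1<p))
    (inj₁ (trans (toℕ-mod (suc s)) (≡-sym (toℕ-mod+1 s))))

  V-adjacent : ∀ s d → 2 ≤ d → 2 + d ≤ p → adj G (V s) (V (d + s)) ≡ true
  V-adjacent s d@(suc (suc e)) (s≤s (s≤s z≤n)) 2+d≤p =
    ¬-not (not-consecutive ∘ Equivalence.to (nonadjacent⇔consecutive _ _ (mod-distinct s z<s (<⇒≤ 2+d≤p))))
    where
    not-consecutive : ¬ Consecutive p (s mod p) ((d + s) mod p)
    not-consecutive (inj₁ eq) = [d+m]%n≢m%n (suc s) z<s (<⇒≤ (<⇒≤ 2+d≤p)) (begin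
      (suc e + suc s) % p          ≡⟨ cong (_% p) (+-suc (suc e) s) ⟩
      (d + s) % p                  ≡⟨ ≡-sym (toℕ-mod (d + s)) ⟩
      toℕ ((d + s) mod p)          ≡⟨ eq ⟩
      (toℕ (s mod p) + 1) % p      ≡⟨ toℕ-mod+1 s ⟩
      suc s % p                    ∎)
    not-consecutive (inj₂ eq) = [d+m]%n≢m%n s z<s 2+d≤p (≡-sym (begin
      s % p                        ≡⟨ ≡-sym (toℕ-mod s) ⟩
      toℕ (s mod p)                ≡⟨ eq ⟩
      (toℕ ((d + s) mod p) + 1) % p ≡⟨ toℕ-mod+1 (d + s) ⟩
      (suc d + s) % p              ∎))

lemma3p2 : ∀ {n} (G : Graph n) → BullFree G → ChairFree G →
    ∀ (p : ℕ) (v : Fin p → Fin n) → IsOddAntihole G p v →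
    ∀ (w w' : Fin n) → InN₂ G v w → InN G v w' → adj G w w' ≡ true →
    ∀ (i : Fin p) → adj G w' (v i) ≡ true
lemma3p2 G bullFree chairFree zero v (() , _) _ _ _ _ _ _
lemma3p2 G bullFree chairFree (suc m) v (5≤p , _ , _ , nonadjacent⇔consecutive)
  w w′ (w∉Q , w∉N , _) (_ , a , w′∼a) ww′ i =
  ¬-not λ w′≁i →
    let s , w′∼Vs , w′≁V1+s = turning-point w′≁i
    in [ bullFree , chairFree ]′ (bull-or-chair-at s w′∼Vs (¬-not w′≁V1+s))
  where
  open CyclicIndexing G m v nonadjacent⇔consecutive

  turning-point : adj G w′ (v i) ≡ false → ∃[ s ] adj G w′ (V s) ≡ true × adj G w′ (V (suc s)) ≢ true
  turning-point w′≁i = crossing (λ s → adj G w′ (V s) ≟ᵇ true)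
    (≤-trans (<⇒≤ (toℕ<n a)) (m≤n+m (suc m) (toℕ i)))
    (trans (cong (adj G w′) (V-toℕ a)) w′∼a)
    (not-¬ w′≁i ∘ trans (cong (adj G w′) (≡-sym (trans (V-periodic (toℕ i)) (V-toℕ i)))))

  w≁V : ∀ s → adj G w (V s) ≡ false
  w≁V s = ¬-not λ w∼V → w∉N (w∉Q , _ , w∼V)

  bull-or-chair-at : ∀ s → adj G w′ (V s) ≡ true → adj G w′ (V (suc s)) ≡ false →
    ContainsInduced G 5 bullAdj ⊎ ContainsInduced G 5 chairAdj
  bull-or-chair-at s w′∼Vs w′≁V1+s = BullOrChair.bull-or-chair G ww′ w′∼Vs w′≁V1+s
    (w≁V s) (w≁V (1 + s)) (w≁V (2 + s)) (w≁V (3 + s))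
    (V-nonadjacent-suc 1<p s) (V-nonadjacent-suc 1<p (1 + s)) (V-nonadjacent-suc 1<p (2 + s))
    (V-adjacent s 2 ≤-refl 4≤p) (V-adjacent (1 + s) 2 ≤-refl 4≤p) (V-adjacent s 3 (s≤s (s≤s z≤n)) 5≤p)
    where
    4≤p : 4 ≤ suc m
    4≤p = <⇒≤ 5≤p
    1<p : 1 < suc m
    1<p = ≤-trans (s≤s (s≤s z≤n)) 5≤p
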